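{- Let $G$ be a 2-connected graph with maximum degree $\Delta(G)$. Then $\phi(G)\ge \lfloor \Delta(G)/2\rfloor$.
   Context: Graphs are simple. $\phi(G)$ denotes the maximum number of pairwise edge-disjoint cycles in $G$. -}

module Defs where

open import Data.Nat using (ℕ; zero; suc; _≤_; _⊔_; _+_)
open import Data.Bool using (Bool; true; false; if_then_else_)
open import Data.Fin using (Fin)
open import Data.List using (List; []; _∷_; length; map; foldr; allFin)
open import Data.Nat.ListAction using (sum)
open import Data.List.Relation.Unary.All using (All)
open import Data.List.Relation.Unary.Unique.Propositional using (Unique)
open import Data.List.Membership.Propositional using (_∈_)
open import Data.Product using (_×_; _,_)
open import Data.Sum using (_⊎_)
open import Data.Unit using (⊤)
open import Relation.Nullary using (¬_)
open import Relation.Binary.PropositionalEquality using (_≡_; _≢_)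

record Graph : Set where
  field
    n      : ℕ
    adj    : Fin n → Fin n → Bool
    sym    : ∀ u v → adj u v ≡ adj v u
    irrefl : ∀ v → adj v v ≡ false

open Graph public

Adj : (G : Graph) → Fin (n G) → Fin (n G) → Set
Adj G u v = adj G u v ≡ true

degree : (G : Graph) → Fin (n G) → ℕ
degree G v = sum (map (λ u → if adj G v u then 1 else 0) (allFin (n G)))

-- maximum degree Δ(G) (0 for the empty graph)
maxDegree : (G : Graph) → ℕ
maxDegree G = foldr _⊔_ 0 (map (degree G) (allFin (n G)))

-- Walks inside the induced subgraph on vertices satisfying P
data WalkIn (G : Graph) (P : Fin (n G) → Set) : Fin (n G) → Fin (n G) → Set where
  here : ∀ {u} → P u → WalkIn G P u u
  step : ∀ {u w v} → P u → Adj G u w → WalkIn G P w v → WalkIn G P u v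

Connected : Graph → Set
Connected G = ∀ u v → WalkIn G (λ _ → ⊤) u v

ConnectedWithout : (G : Graph) → Fin (n G) → Set
ConnectedWithout G x = ∀ u v → u ≢ x → v ≢ x → WalkIn G (λ w → w ≢ x) u v

TwoConnected : Graph → Set
TwoConnected G = (3 ≤ n G) × Connected G × (∀ x → ConnectedWithout G x)

-- consecutive pairs of a cyclic vertex sequence [v0,...,vk] :
-- (v0,v1),(v1,v2),...,(vk,v0)
closedPairsFrom : {A : Set} → A → List A → List (A × A)
closedPairsFrom x0 [] = []
closedPairsFrom x0 (y ∷ []) = (y , x0) ∷ []
closedPairsFrom x0 (y ∷ z ∷ r) = (y , z) ∷ closedPairsFrom x0 (z ∷ r)

closedPairs : {A : Set} → List A → List (A × A)
closedPairs [] = []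
closedPairs (x ∷ xs) = closedPairsFrom x (x ∷ xs)

record Cycle (G : Graph) : Set where
  field
    verts    : List (Fin (n G))
    long     : 3 ≤ length verts
    distinct : Unique verts
    adjacent : All (λ p → Adj G (Data.Product.proj₁ p) (Data.Product.proj₂ p)) (closedPairs verts)

open Cycle public

UsesEdge : {G : Graph} → Cycle G → Fin (n G) → Fin (n G) → Set
UsesEdge C a b = ((a , b) ∈ closedPairs (verts C)) ⊎ ((b , a) ∈ closedPairs (verts C))

EdgeDisjoint : {G : Graph} → Cycle G → Cycle G → Set
EdgeDisjoint C D = ∀ a b → UsesEdge C a b → ¬ UsesEdge D a b

-- φ(G) ≥ k : there are k pairwise edge-disjoint cycles in G
PhiAtLeast : Graph → ℕ → Set
PhiAtLeast G k = Data.Product.Σ (Fin k → Cycle G) λ cs →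
  ∀ i j → i ≢ j → EdgeDisjoint (cs i) (cs j)

-- Let v be a vertex of maximum degree Δ and pair up 2⌊Δ/2⌋ of its neighbours.  As G − v
-- is connected, each pair is joined by a walk avoiding v.  While two of these walks share
-- an edge, cut both at that edge and rejoin the four halves the other way round: the new
-- walks join the same neighbours in a different pairing and are two edges shorter in
-- total, so the process ends with pairwise edge-disjoint walks.  Shortening each walk to a
-- path and closing it through v yields ⌊Δ/2⌋ edge-disjoint cycles: their edges at v are
-- distinct because the paired neighbours are, and their other edges lie on different walks.

module Submission where

open import Defs
open import Data.Nat using (ℕ; zero; suc; _≤_; _<_; _+_; _*_; z≤n; s≤s; z<s; _/_)
import Data.Nat.Properties as ℕ
open import Data.Nat.DivMod using (m/n*n≤m; /-monoˡ-≤)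
open import Data.Nat.Induction using (<-wellFounded)
open import Data.Nat.ListAction using (sum)
open import Data.Nat.ListAction.Properties using (sum-↭)
open import Data.Nat.Tactic.RingSolver using (solve-∀)
open import Data.Bool using (Bool; true; false; if_then_else_) renaming (_≟_ to _≟ᵇ_)
open import Data.Fin using (Fin; zero; suc; inject≤; fromℕ<) renaming (_≟_ to _≟ᶠ_)
open import Data.Fin.Properties using (inject≤-injective)
open import Data.List using (List; []; _∷_; _++_; length; map; allFin; filter; lookup)
open import Data.List.Properties using (foldr-preservesᵇ)
open import Data.List.Relation.Unary.All as All using (All; []; _∷_)
open import Data.List.Relation.Unary.All.Properties using (¬Any⇒All¬; all-filter)
  renaming (++⁺ to All-++⁺; map⁺ to All-map⁺)
open import Data.List.Relation.Unary.Any using (Any; here; there; any?)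
open import Data.List.Relation.Unary.AllPairs as AllPairs using (AllPairs; []; _∷_)
open import Data.List.Relation.Unary.Unique.Propositional using (Unique)
open import Data.List.Relation.Unary.Unique.Propositional.Properties using (allFin⁺)
import Data.List.Relation.Unary.Unique.Propositional.Properties as Unique
open import Data.List.Relation.Binary.Disjoint.Propositional using (Disjoint)
open import Data.List.Relation.Binary.Subset.Propositional using (_⊆_)
open import Data.List.Relation.Binary.Permutation.Propositional as Perm
  using (_↭_; ↭-refl; ↭-prep; ↭-sym; ↭-trans; ↭⇒↭ₛ)
open import Data.List.Relation.Binary.Permutation.Propositional.Properties
  using (All-resp-↭; ↭-length; ++⁺ˡ; ++⁺ʳ; shift; shifts) renaming (map⁺ to ↭-map⁺)
import Data.List.Relation.Binary.Permutation.Setoid.Properties as ↭ₛ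
open import Data.List.Membership.Propositional using (_∈_; find; lose)
open import Data.List.Membership.Propositional.Properties using (∈-∃++; ∈-++⁻; ∈-lookup)
import Data.List.Membership.DecPropositional as DecMembership
open import Data.List.Extrema ℕ.≤-totalOrder using (argmax; f[xs]≤f[argmax])
import Data.Product as Product
open import Data.Product using (Σ; ∃; ∃₂; _×_; _,_; proj₁; proj₂; uncurry)
open import Data.Product.Properties using (≡-dec)
open import Data.Sum using (_⊎_; inj₁; inj₂)
import Data.Sum as Sum
open import Data.Empty using (⊥-elim)
open import Function using (_∘_; _on_)
open import Induction.WellFounded using (Acc; acc)
import Relation.Binary.Construct.On as On
open import Relation.Binary.Core using (Rel)
open import Relation.Binary.Definitions using (Decidable)
open import Relation.Nullary using (¬_; yes; no)
open import Relation.Nullary.Decidable using (_⊎-dec_)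
open import Relation.Binary.PropositionalEquality as ≡
  using (_≡_; _≢_; refl; cong; subst; ≢-sym)

Unique-resp-↭ : {A : Set} {xs ys : List A} → xs ↭ ys → Unique xs → Unique ys
Unique-resp-↭ {A} p = ↭ₛ.Unique-resp-↭ (≡.setoid A) (↭⇒↭ₛ p)

sum-indicator≡length-filter : {A : Set} (f : A → Bool) (xs : List A) →
                              sum (map (λ x → if f x then 1 else 0) xs) ≡
                              length (filter (λ x → f x ≟ᵇ true) xs)
sum-indicator≡length-filter f []       = refl
sum-indicator≡length-filter f (x ∷ xs) with f x
... | true  = cong suc (sum-indicator≡length-filter f xs)
... | false = sum-indicator≡length-filter f xs

module _ {a r} {A : Set a} {R : Rel A r} where

  AllPairs-lookup : ∀ {xs} → AllPairs R xs → ∀ {i j} → i ≢ j →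
                    R (lookup xs i) (lookup xs j) ⊎ R (lookup xs j) (lookup xs i)
  AllPairs-lookup (Rx ∷ Rxs) {zero}  {zero}  i≢j = ⊥-elim (i≢j refl)
  AllPairs-lookup (Rx ∷ Rxs) {zero}  {suc j} i≢j = inj₁ (All.lookup Rx (∈-lookup j))
  AllPairs-lookup (Rx ∷ Rxs) {suc i} {zero}  i≢j = inj₂ (All.lookup Rx (∈-lookup i))
  AllPairs-lookup (Rx ∷ Rxs) {suc i} {suc j} i≢j = AllPairs-lookup Rxs (i≢j ∘ cong suc)

  findRelatedPair : Decidable R → (xs : List A) →
                    AllPairs (λ x y → ¬ R x y) xs ⊎
                    ∃₂ λ x y → R x y × ∃ λ rest → xs ↭ x ∷ y ∷ rest
  findRelatedPair R? [] = inj₁ []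
  findRelatedPair R? (x ∷ xs) with any? (R? x) xs
  ... | yes xRxs with find xRxs
  ...   | y , y∈xs , xRy with ∈-∃++ y∈xs
  ...     | ys , zs , refl = inj₂ (x , y , xRy , ys ++ zs , ↭-prep x (shift y ys zs))
  findRelatedPair R? (x ∷ xs) | no ¬xRxs with findRelatedPair R? xs
  ... | inj₁ unrelated = inj₁ (¬Any⇒All¬ xs ¬xRxs ∷ unrelated)
  ... | inj₂ (y , z , yRz , rest , xs↭) =
    inj₂ (y , z , yRz , x ∷ rest , ↭-trans (↭-prep x xs↭) (shifts (x ∷ []) (y ∷ z ∷ [])))

module _ (G : Graph) where

  private
    V = Fin (n G)

  Adj-sym : ∀ {x y} → Adj G x y → Adj G y x
  Adj-sym {x} {y} xy = ≡.trans (sym G y x) xy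

  Adj⇒≢ : ∀ {x y} → Adj G x y → y ≢ x
  Adj⇒≢ {x} xx refl with ≡.trans (≡.sym xx) (irrefl G x)
  ... | ()

  neighbours : Fin (n G) → List V
  neighbours v = filter (λ u → adj G v u ≟ᵇ true) (allFin (n G))

  degree≡length-neighbours : ∀ v → degree G v ≡ length (neighbours v)
  degree≡length-neighbours v = sum-indicator≡length-filter (adj G v) (allFin (n G))

  neighbours-Adj : ∀ v → All (Adj G v) (neighbours v)
  neighbours-Adj v = all-filter (λ u → adj G v u ≟ᵇ true) (allFin (n G))

  neighbours-Unique : ∀ v → Unique (neighbours v)
  neighbours-Unique v = Unique.filter⁺ (λ u → adj G v u ≟ᵇ true) (allFin⁺ (n G))

  maxDegree-attained : 0 < n G → Σ V λ v → maxDegree G ≤ degree G v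
  maxDegree-attained 0<n =
    v , foldr-preservesᵇ {P = _≤ degree G v} ℕ.⊔-lub z≤n
          (All-map⁺ (f[xs]≤f[argmax] {f = degree G} v₀ vs))
    where
      v₀ = fromℕ< 0<n
      vs = allFin (n G)
      v  = argmax (degree G) v₀ vs

  EdgeDisjoint-sym : {C D : Cycle G} → EdgeDisjoint C D → EdgeDisjoint D C
  EdgeDisjoint-sym C∩D x y xy∈D xy∈C = C∩D x y xy∈C xy∈D

  PhiAtLeast-mono : ∀ {k m} → k ≤ m → PhiAtLeast G m → PhiAtLeast G k
  PhiAtLeast-mono k≤m (cycle , disjoint) =
    cycle ∘ inject≤′ , λ i j i≢j → disjoint _ _ (i≢j ∘ inject≤-injective k≤m k≤m i j)
    where inject≤′ = λ i → inject≤ i k≤m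

module Walks (G : Graph) (P : Fin (n G) → Set) where

  private
    V = Fin (n G)
    variable
      a b c x y : V

  Walk : V → V → Set
  Walk = WalkIn G P

  walkLength : Walk a b → ℕ
  walkLength (here _)     = 0
  walkLength (step _ _ w) = suc (walkLength w)

  edges : Walk a b → List (V × V)
  edges (here _)               = []
  edges (step {a} {x} _ _ w) = (a , x) ∷ edges w

  vertices : Walk a b → List V
  vertices (here {a} _)     = a ∷ []
  vertices (step {a} _ _ w) = a ∷ vertices w

  P-start : Walk a b → P a
  P-start (here Pa)       = Pa
  P-start (step Pa _ _)   = Pa

  _++ʷ_ : Walk a b → Walk b c → Walk a c
  here _      ++ʷ w' = w'
  step Pa e w ++ʷ w' = step Pa e (w ++ʷ w')

  walkLength-++ʷ : (w : Walk a b) (w' : Walk b c) → walkLength (w ++ʷ w') ≡ walkLength w + walkLength w'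
  walkLength-++ʷ (here _)     w' = refl
  walkLength-++ʷ (step _ _ w) w' = cong suc (walkLength-++ʷ w w')

  reverseʷ : Walk a b → Walk b a
  reverseʷ (here Pa)     = here Pa
  reverseʷ (step Pa e w) = reverseʷ w ++ʷ step (P-start w) (Adj-sym G e) (here Pa)

  walkLength-reverseʷ : (w : Walk a b) → walkLength (reverseʷ w) ≡ walkLength w
  walkLength-reverseʷ (here _)      = refl
  walkLength-reverseʷ (step Pa e w) = begin
    walkLength (reverseʷ w ++ʷ _) ≡⟨ walkLength-++ʷ (reverseʷ w) _ ⟩
    walkLength (reverseʷ w) + 1   ≡⟨ ℕ.+-comm _ 1 ⟩
    suc (walkLength (reverseʷ w)) ≡⟨ cong suc (walkLength-reverseʷ w) ⟩
    suc (walkLength w)            ∎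
    where open ≡.≡-Reasoning

  split-at-edge : (w : Walk a b) → (x , y) ∈ edges w →
                  Σ (Walk a x) λ u → Σ (Walk y b) λ u' → suc (walkLength u + walkLength u') ≡ walkLength w
  split-at-edge (step Pa e w) (here refl) = here Pa , w , refl
  split-at-edge (step Pa e w) (there xy∈w) with split-at-edge w xy∈w
  ... | u , u' , eq = step Pa e u , u' , cong suc eq

  edges-P : (w : Walk a b) → (x , y) ∈ edges w → P x × P y
  edges-P (step Pa e w) (here refl)  = Pa , P-start w
  edges-P (step Pa e w) (there xy∈w) = edges-P w xy∈w

  vertices-P : (w : Walk a b) → All P (vertices w)
  vertices-P (here Pa)     = Pa ∷ []
  vertices-P (step Pa _ w) = Pa ∷ vertices-P w

  edges-Adj : (w : Walk a b) → All (uncurry (Adj G)) (edges w)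
  edges-Adj (here _)     = []
  edges-Adj (step _ e w) = e ∷ edges-Adj w

  closedPairsFrom-vertices : (w : Walk a b) → closedPairsFrom x (vertices w) ≡ edges w ++ (b , x) ∷ []
  closedPairsFrom-vertices (here _)                = refl
  closedPairsFrom-vertices (step _ _ (here _))     = refl
  closedPairsFrom-vertices (step {a} {c} _ _ w@(step _ _ _)) = cong ((a , c) ∷_) (closedPairsFrom-vertices w)

  suffix : (w : Walk a b) → x ∈ vertices w →
           Σ (Walk x b) λ w' → edges w' ⊆ edges w × (Unique (vertices w) → Unique (vertices w'))
  suffix w@(here _)   (here refl) = w , (λ e → e) , (λ u → u)
  suffix w@(step _ _ _) (here refl) = w , (λ e → e) , (λ u → u)
  suffix (step _ _ w) (there x∈w) with suffix w x∈w
  ... | w' , sub , uniq = w' , there ∘ sub , λ { (_ ∷ u) → uniq u }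

  open DecMembership (_≟ᶠ_ {n G}) using (_∈?_)

  shortcut : (w : Walk a b) → Σ (Walk a b) λ p → Unique (vertices p) × edges p ⊆ edges w
  shortcut (here Pa) = here Pa , [] ∷ [] , λ ()
  shortcut (step {a} Pa e w) with shortcut w
  ... | p , uniq , sub with a ∈? vertices p
  ...   | yes a∈p = let (p' , sub' , uniq') = suffix p a∈p in p' , uniq' uniq , there ∘ sub ∘ sub'
  ...   | no  a∉p =
    step Pa e p , ¬Any⇒All¬ _ a∉p ∷ uniq , λ { (here eq) → here eq ; (there e∈p) → there (sub e∈p) }

  record Link : Set where
    constructor link
    field
      src dst : V
      walk    : Walk src dst

  open Link public

  ends : Link → List V
  ends ℓ = src ℓ ∷ dst ℓ ∷ []

  weight : Link → ℕ
  weight = walkLength ∘ walk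

  endpoints : List Link → List V
  endpoints []      = []
  endpoints (ℓ ∷ l) = ends ℓ ++ endpoints l

  totalWeight : List Link → ℕ
  totalWeight = sum ∘ map weight

  endpoints-↭ : ∀ {l l'} → l ↭ l' → endpoints l ↭ endpoints l'
  endpoints-↭ Perm.refl          = ↭-refl
  endpoints-↭ (Perm.prep ℓ p)     = ++⁺ˡ (ends ℓ) (endpoints-↭ p)
  endpoints-↭ (Perm.swap ℓ ℓ' p)  =
    ↭-trans (shifts (ends ℓ) (ends ℓ')) (++⁺ˡ (ends ℓ' ++ ends ℓ) (endpoints-↭ p))
  endpoints-↭ (Perm.trans p q)    = ↭-trans (endpoints-↭ p) (endpoints-↭ q)

  totalWeight-↭ : ∀ {l l'} → l ↭ l' → totalWeight l ≡ totalWeight l'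
  totalWeight-↭ p = sum-↭ (↭-map⁺ weight p)

  endpoints-All⁻ : ∀ {Q : V → Set} {l} → All Q (endpoints l) → All (All Q ∘ ends) l
  endpoints-All⁻ {l = []}    []              = []
  endpoints-All⁻ {l = _ ∷ _} (Qs ∷ Qd ∷ Qrest) = (Qs ∷ Qd ∷ []) ∷ endpoints-All⁻ Qrest

  endpoints-Unique⁻ : ∀ {l} → Unique (endpoints l) →
                      All (λ ℓ → src ℓ ≢ dst ℓ) l ×
                      AllPairs (λ ℓ ℓ' → Disjoint (ends ℓ) (ends ℓ')) l
  endpoints-Unique⁻ {[]}    []                            = [] , []
  endpoints-Unique⁻ {ℓ ∷ l} ((s≢d ∷ s≢rest) ∷ d≢rest ∷ uniq) =
    s≢d ∷ proj₁ (endpoints-Unique⁻ uniq) ,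
    All.zipWith (λ {ℓ'} → apart {ℓ'}) (endpoints-All⁻ s≢rest , endpoints-All⁻ d≢rest) ∷
      proj₂ (endpoints-Unique⁻ uniq)
    where
      apart : ∀ {ℓ'} → All (src ℓ ≢_) (ends ℓ') × All (dst ℓ ≢_) (ends ℓ') →
              Disjoint (ends ℓ) (ends ℓ')
      apart (s≢ , d≢) (here refl         , x∈ℓ') = All.lookup s≢ x∈ℓ' refl
      apart (s≢ , d≢) (there (here refl) , x∈ℓ') = All.lookup d≢ x∈ℓ' refl

  HasEdge : Link → V → V → Set
  HasEdge ℓ x y = (x , y) ∈ edges (walk ℓ) ⊎ (y , x) ∈ edges (walk ℓ)

  Shared : Link → Link → Set
  Shared ℓ ℓ' = Any (uncurry (HasEdge ℓ')) (edges (walk ℓ))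

  private
    module DecEdges = DecMembership (≡-dec (_≟ᶠ_ {n G}) (_≟ᶠ_ {n G}))

  shared? : Decidable Shared
  shared? ℓ ℓ' = any? hasEdge? (edges (walk ℓ))
    where
      hasEdge? = λ (x , y) →
        (x , y) DecEdges.∈? edges (walk ℓ') ⊎-dec (y , x) DecEdges.∈? edges (walk ℓ')

  shared : ∀ {ℓ ℓ' x y} → HasEdge ℓ x y → HasEdge ℓ' x y → Shared ℓ ℓ'
  shared (inj₁ xy∈ℓ) h' = lose xy∈ℓ h'
  shared (inj₂ yx∈ℓ) h' = lose yx∈ℓ (Sum.swap h')

  HasEdge-P : ∀ {ℓ x y} → HasEdge ℓ x y → P x × P y
  HasEdge-P {ℓ} (inj₁ xy∈ℓ) = edges-P (walk ℓ) xy∈ℓ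
  HasEdge-P {ℓ} (inj₂ yx∈ℓ) = Product.swap (edges-P (walk ℓ) yx∈ℓ)

  private
    rejoin-same-direction : ∀ p q r s → suc (p + q) + suc (r + s) ≡ (p + r) + (q + s) + 2
    rejoin-same-direction = solve-∀

    rejoin-opposite-direction : ∀ p q r s → suc (p + q) + suc (r + s) ≡ (p + s) + (r + q) + 2
    rejoin-opposite-direction = solve-∀

    <-by-two : ∀ {m n} → n ≡ m + 2 → m < n
    <-by-two {m} refl = ℕ.m<m+n m z<s

  uncross : ∀ {ℓ ℓ'} → Shared ℓ ℓ' →
            Σ Link λ ℓ₁ → Σ Link λ ℓ₂ →
              weight ℓ₁ + weight ℓ₂ < weight ℓ + weight ℓ' ×
              ends ℓ₁ ++ ends ℓ₂ ↭ ends ℓ ++ ends ℓ'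
  uncross {link a b w} {link c d w'} sh with find sh
  ... | (x , y) , xy∈w , inj₁ xy∈w' with split-at-edge w xy∈w | split-at-edge w' xy∈w'
  ...   | A , B , |w| | C , D , |w'| =
    link a c (A ++ʷ reverseʷ C) , link b d (reverseʷ B ++ʷ D) , <-by-two lengths ,
    ↭-prep a (Perm.swap c b ↭-refl)
    where
      lengths : walkLength w + walkLength w' ≡
                walkLength (A ++ʷ reverseʷ C) + walkLength (reverseʷ B ++ʷ D) + 2
      lengths rewrite walkLength-++ʷ A (reverseʷ C) | walkLength-++ʷ (reverseʷ B) D
                    | walkLength-reverseʷ B | walkLength-reverseʷ C | ≡.sym |w| | ≡.sym |w'| =
        rejoin-same-direction (walkLength A) (walkLength B) (walkLength C) (walkLength D)
  uncross {link a b w} {link c d w'} sh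
      | (x , y) , xy∈w , inj₂ yx∈w' with split-at-edge w xy∈w | split-at-edge w' yx∈w'
  ...   | A , B , |w| | C , D , |w'| =
    link a d (A ++ʷ D) , link c b (C ++ʷ B) , <-by-two lengths ,
    ↭-prep a (↭-trans (Perm.swap d c ↭-refl)
             (↭-trans (↭-prep c (Perm.swap d b ↭-refl)) (Perm.swap c b ↭-refl)))
    where
      lengths : walkLength w + walkLength w' ≡ walkLength (A ++ʷ D) + walkLength (C ++ʷ B) + 2
      lengths rewrite walkLength-++ʷ A D | walkLength-++ʷ C B | ≡.sym |w| | ≡.sym |w'| =
        rejoin-opposite-direction (walkLength A) (walkLength B) (walkLength C) (walkLength D)

  record Rerouting (l' l : List Link) : Set where
    constructor rerouting
    field
      endpoints↭ : endpoints l' ↭ endpoints l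
      length≡    : length l' ≡ length l

  Rerouting-trans : ∀ {l l' l''} → Rerouting l'' l' → Rerouting l' l → Rerouting l'' l
  Rerouting-trans (rerouting ends↭ length≡) (rerouting ends↭′ length≡′) =
    rerouting (↭-trans ends↭ ends↭′) (≡.trans length≡ length≡′)

  reroute : ∀ {ℓ ℓ' l rest} → Shared ℓ ℓ' → l ↭ ℓ ∷ ℓ' ∷ rest →
            Σ (List Link) λ l₁ → totalWeight l₁ < totalWeight l × Rerouting l₁ l
  reroute {ℓ} {ℓ'} {l} {rest} sh l↭ with uncross sh
  ... | ℓ₁ , ℓ₂ , lighter , ends↭ =
    ℓ₁ ∷ ℓ₂ ∷ rest , totalWeight< , rerouting endpoints↭ (↭-length (↭-sym l↭))
    where
      open ℕ.≤-Reasoning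
      totalWeight< : totalWeight (ℓ₁ ∷ ℓ₂ ∷ rest) < totalWeight l
      totalWeight< = begin-strict
        weight ℓ₁ + (weight ℓ₂ + totalWeight rest) ≡⟨ ℕ.+-assoc (weight ℓ₁) _ _ ⟨
        weight ℓ₁ + weight ℓ₂ + totalWeight rest   <⟨ ℕ.+-monoˡ-< (totalWeight rest) lighter ⟩
        weight ℓ + weight ℓ' + totalWeight rest    ≡⟨ ℕ.+-assoc (weight ℓ) _ _ ⟩
        totalWeight (ℓ ∷ ℓ' ∷ rest)                ≡⟨ totalWeight-↭ l↭ ⟨
        totalWeight l                              ∎
      endpoints↭ : endpoints (ℓ₁ ∷ ℓ₂ ∷ rest) ↭ endpoints l
      endpoints↭ = ↭-trans (++⁺ʳ (endpoints rest) ends↭) (endpoints-↭ (↭-sym l↭))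

  Unshared : Link → Link → Set
  Unshared ℓ ℓ' = ¬ Shared ℓ ℓ'

  untangle : ∀ l → Σ (List Link) λ l' → Rerouting l' l × AllPairs Unshared l'
  untangle l = go l (On.wellFounded totalWeight <-wellFounded l)
    where
      go : ∀ l → Acc (_<_ on totalWeight) l → Σ (List Link) λ l' → Rerouting l' l × AllPairs Unshared l'
      go l (acc smaller) with findRelatedPair shared? l
      ... | inj₁ unshared = l , rerouting ↭-refl refl , unshared
      ... | inj₂ (_ , _ , sh , _ , l↭) with reroute sh l↭
      ...   | l₁ , lighter , l₁≈l with go l₁ (smaller lighter)
      ...     | l' , l'≈l₁ , unshared = l' , Rerouting-trans l'≈l₁ l₁≈l , unshared

module Spokes (G : Graph) (v : Fin (n G)) where

  open Walks G (_≢ v)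

  private
    V = Fin (n G)
    variable
      a b x y : V

  closedPairs-spoke : (p : Walk a b) → closedPairs (v ∷ vertices p) ≡ (v , a) ∷ edges p ++ (b , v) ∷ []
  closedPairs-spoke (here _)         = refl
  closedPairs-spoke p@(step _ _ _)   = cong ((v , _) ∷_) (closedPairsFrom-vertices p)

  spokeCycle : (p : Walk a b) → Unique (vertices p) → a ≢ b → Adj G v a → Adj G v b → Cycle G
  spokeCycle {a} {b} p uniq a≢b va vb = record
    { verts    = v ∷ vertices p
    ; long     = at-least-three p a≢b
    ; distinct = All.map ≢-sym (vertices-P p) ∷ uniq
    ; adjacent = subst (All (uncurry (Adj G))) (≡.sym (closedPairs-spoke p))
                       (va ∷ All-++⁺ (edges-Adj p) (Adj-sym G vb ∷ []))
    }
    where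
      at-least-three : (p : Walk a b) → a ≢ b → 3 ≤ length (v ∷ vertices p)
      at-least-three (here _)                 a≢a = ⊥-elim (a≢a refl)
      at-least-three (step _ _ (here _))      _   = s≤s (s≤s (s≤s z≤n))
      at-least-three (step _ _ (step _ _ _))  _   = s≤s (s≤s (s≤s z≤n))

  spokeCycle-pairs : (p : Walk a b) (uniq : Unique (vertices p)) (a≢b : a ≢ b)
                     (va : Adj G v a) (vb : Adj G v b) →
                     (x , y) ∈ closedPairs (verts (spokeCycle p uniq a≢b va vb)) →
                     (x ≡ v × y ≡ a) ⊎ (x , y) ∈ edges p ⊎ (x ≡ b × y ≡ v)
  spokeCycle-pairs p _ _ _ _ xy∈C with subst (_ ∈_) (closedPairs-spoke p) xy∈C
  ... | here refl = inj₁ (refl , refl)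
  ... | there xy∈ with ∈-++⁻ (edges p) xy∈
  ...   | inj₁ xy∈p          = inj₂ (inj₁ xy∈p)
  ...   | inj₂ (here refl)   = inj₂ (inj₂ (refl , refl))

  linkCycle : (ℓ : Link) → src ℓ ≢ dst ℓ → All (Adj G v) (ends ℓ) → Cycle G
  linkCycle (link a b w) a≢b (va ∷ vb ∷ []) =
    spokeCycle (proj₁ (shortcut w)) (proj₁ (proj₂ (shortcut w))) a≢b va vb

  SpokeEdge : Link → V → V → Set
  SpokeEdge ℓ x y = (x ≡ v × y ∈ ends ℓ) ⊎ (y ≡ v × x ∈ ends ℓ)

  linkCycle-pair : ∀ ℓ s≢d spokes → (x , y) ∈ closedPairs (verts (linkCycle ℓ s≢d spokes)) →
                   SpokeEdge ℓ x y ⊎ (x , y) ∈ edges (walk ℓ)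
  linkCycle-pair (link a b w) a≢b (va ∷ vb ∷ []) xy∈C
    with spokeCycle-pairs (proj₁ (shortcut w)) (proj₁ (proj₂ (shortcut w))) a≢b va vb xy∈C
  ... | inj₁ (x≡v , y≡a)        = inj₁ (inj₁ (x≡v , here y≡a))
  ... | inj₂ (inj₁ xy∈p)        = inj₂ (proj₂ (proj₂ (shortcut w)) xy∈p)
  ... | inj₂ (inj₂ (x≡b , y≡v)) = inj₁ (inj₂ (y≡v , there (here x≡b)))

  linkCycle-edge : ∀ ℓ s≢d spokes → UsesEdge (linkCycle ℓ s≢d spokes) x y →
                   SpokeEdge ℓ x y ⊎ HasEdge ℓ x y
  linkCycle-edge ℓ s≢d spokes (inj₁ xy∈C) = Sum.map₂ inj₁ (linkCycle-pair ℓ s≢d spokes xy∈C)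
  linkCycle-edge ℓ s≢d spokes (inj₂ yx∈C) = Sum.map Sum.swap inj₂ (linkCycle-pair ℓ s≢d spokes yx∈C)

  linkCycles-EdgeDisjoint : ∀ {ℓ ℓ'} s≢d spokes s≢d' spokes' →
                            Disjoint (ends ℓ) (ends ℓ') → Unshared ℓ ℓ' →
                            EdgeDisjoint (linkCycle ℓ s≢d spokes) (linkCycle ℓ' s≢d' spokes')
  linkCycles-EdgeDisjoint {ℓ} {ℓ'} s≢d spokes s≢d' spokes' apart unshared x y xy∈C xy∈C' =
    separate (linkCycle-edge ℓ s≢d spokes xy∈C) (linkCycle-edge ℓ' s≢d' spokes' xy∈C')
    where
      not-v : ∀ {ℓ} → All (Adj G v) (ends ℓ) → ∀ {z} → z ∈ ends ℓ → z ≢ v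
      not-v spokes z∈ℓ = Adj⇒≢ G (All.lookup spokes z∈ℓ)

      spoke-not-walk : ∀ {ℓ ℓ'} → SpokeEdge ℓ x y → ¬ HasEdge ℓ' x y
      spoke-not-walk (inj₁ (x≡v , _)) xy∈ℓ' = proj₁ (HasEdge-P xy∈ℓ') x≡v
      spoke-not-walk (inj₂ (y≡v , _)) xy∈ℓ' = proj₂ (HasEdge-P xy∈ℓ') y≡v

      separate : SpokeEdge ℓ x y ⊎ HasEdge ℓ x y → ¬ (SpokeEdge ℓ' x y ⊎ HasEdge ℓ' x y)
      separate (inj₁ (inj₁ (_ , y∈ℓ))) (inj₁ (inj₁ (_ , y∈ℓ'))) = apart (y∈ℓ , y∈ℓ')
      separate (inj₁ (inj₂ (_ , x∈ℓ))) (inj₁ (inj₂ (_ , x∈ℓ'))) = apart (x∈ℓ , x∈ℓ')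
      separate (inj₁ (inj₁ (x≡v , _))) (inj₁ (inj₂ (_ , x∈ℓ'))) = not-v {ℓ'} spokes' x∈ℓ' x≡v
      separate (inj₁ (inj₂ (_ , x∈ℓ))) (inj₁ (inj₁ (x≡v , _)))  = not-v {ℓ} spokes x∈ℓ x≡v
      separate (inj₁ spoke)            (inj₂ xy∈ℓ')             = spoke-not-walk {ℓ} {ℓ'} spoke xy∈ℓ'
      separate (inj₂ xy∈ℓ)             (inj₁ spoke)             = spoke-not-walk {ℓ'} {ℓ} spoke xy∈ℓ
      separate (inj₂ xy∈ℓ)             (inj₂ xy∈ℓ')             = unshared (shared xy∈ℓ xy∈ℓ')

  untangled-links⇒PhiAtLeast : (l : List Link) → Unique (endpoints l) → All (Adj G v) (endpoints l) →
                      AllPairs Unshared l → PhiAtLeast G (length l)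
  untangled-links⇒PhiAtLeast l uniq spokes unshared = cycle , disjoint
    where
      s≢d : ∀ i → src (lookup l i) ≢ dst (lookup l i)
      s≢d i = All.lookup (proj₁ (endpoints-Unique⁻ {l} uniq)) (∈-lookup i)

      spokes-at : ∀ i → All (Adj G v) (ends (lookup l i))
      spokes-at i = All.lookup (endpoints-All⁻ {l = l} spokes) (∈-lookup i)

      cycle : Fin (length l) → Cycle G
      cycle i = linkCycle (lookup l i) (s≢d i) (spokes-at i)

      disjoint : ∀ i j → i ≢ j → EdgeDisjoint (cycle i) (cycle j)
      disjoint i j i≢j with AllPairs-lookup (AllPairs.zip (proj₂ (endpoints-Unique⁻ {l} uniq) , unshared)) i≢j
      ... | inj₁ (apart , unshared-ij) =
        linkCycles-EdgeDisjoint (s≢d i) (spokes-at i) (s≢d j) (spokes-at j) apart unshared-ij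
      ... | inj₂ (apart , unshared-ji) = EdgeDisjoint-sym G {cycle j} {cycle i}
        (linkCycles-EdgeDisjoint (s≢d j) (spokes-at j) (s≢d i) (spokes-at i) apart unshared-ji)

  pairUp : ConnectedWithout G v → (xs : List V) → All (Adj G v) xs → List Link
  pairUp conn []           _                = []
  pairUp conn (_ ∷ [])     _                = []
  pairUp conn (x ∷ y ∷ xs) (vx ∷ vy ∷ vxs) =
    link x y (conn x y (Adj⇒≢ G vx) (Adj⇒≢ G vy)) ∷ pairUp conn xs vxs

  pairUp-All : ∀ {Q : V → Set} conn xs vxs → All Q xs → All Q (endpoints (pairUp conn xs vxs))
  pairUp-All conn []           _               _                = []
  pairUp-All conn (_ ∷ [])     _               _                = []
  pairUp-All conn (x ∷ y ∷ xs) (_ ∷ _ ∷ vxs) (Qx ∷ Qy ∷ Qxs) = Qx ∷ Qy ∷ pairUp-All conn xs vxs Qxs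

  pairUp-Unique : ∀ conn xs vxs → Unique xs → Unique (endpoints (pairUp conn xs vxs))
  pairUp-Unique conn []           _               _                        = []
  pairUp-Unique conn (_ ∷ [])     _               _                        = []
  pairUp-Unique conn (x ∷ y ∷ xs) (_ ∷ _ ∷ vxs) ((x≢y ∷ x≢xs) ∷ y≢xs ∷ u) =
    (x≢y ∷ pairUp-All conn xs vxs x≢xs) ∷ pairUp-All conn xs vxs y≢xs ∷ pairUp-Unique conn xs vxs u

  pairUp-length : ∀ conn k xs vxs → k * 2 ≤ length xs → k ≤ length (pairUp conn xs vxs)
  pairUp-length conn zero    xs           vxs           _              = z≤n
  pairUp-length conn (suc k) (x ∷ y ∷ xs) (_ ∷ _ ∷ vxs) (s≤s (s≤s k*2≤)) =
    s≤s (pairUp-length conn k xs vxs k*2≤)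

  φ≥half-degree : ConnectedWithout G v → PhiAtLeast G (degree G v / 2)
  φ≥half-degree conn with untangle (pairUp conn (neighbours G v) (neighbours-Adj G v))
  ... | l , rerouting l↭ length≡ , unshared =
    PhiAtLeast-mono G enough (untangled-links⇒PhiAtLeast l unique-ends spokes unshared)
    where
      unique-ends : Unique (endpoints l)
      unique-ends = Unique-resp-↭ (↭-sym l↭) (pairUp-Unique conn _ _ (neighbours-Unique G v))

      spokes : All (Adj G v) (endpoints l)
      spokes = All-resp-↭ (↭-sym l↭) (pairUp-All conn _ _ (neighbours-Adj G v))

      enough : degree G v / 2 ≤ length l
      enough = subst (degree G v / 2 ≤_) (≡.sym length≡)
                     (pairUp-length conn _ (neighbours G v) (neighbours-Adj G v) half*2≤)
        where
          half*2≤ = ℕ.≤-trans (m/n*n≤m (degree G v) 2) (ℕ.≤-reflexive (degree≡length-neighbours G v))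

corollary2p2 : (G : Graph) → TwoConnected G → PhiAtLeast G (maxDegree G / 2)
corollary2p2 G (3≤n , _ , no-cut-vertex) with maxDegree-attained G (ℕ.≤-trans (s≤s z≤n) 3≤n)
... | v , Δ≤degree =
  PhiAtLeast-mono G (/-monoˡ-≤ 2 Δ≤degree) (Spokes.φ≥half-degree G v (no-cut-vertex v))
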